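{- For all $C,\delta>0$ there are $\varepsilon>0$ and $n_0\in\mathbb N$ such that every $C$-bipartite-Ramsey graph $G=(V_1,V_2,E)$ with $|V_1|,|V_2|\ge n_0$ is $(\delta,\varepsilon)$-bipartite-rich.
   Context: A bipartite graph $G=(V_1,V_2,E)$ has disjoint finite vertex classes $V_1,V_2$ and edge set $E\subset V_1\times V_2$; $N(v)$ denotes the neighbourhood of $v$. Given $C>0$, $G$ is called $C$-bipartite-Ramsey if for all integers $t_1\ge C\log_2|V_1|$ and $t_2\ge C\log_2|V_2|$ there are no sets $T_1\subset V_1$, $T_2\subset V_2$ with $|T_1|=t_1$, $|T_2|=t_2$ such that either every pair in $T_1\times T_2$ is an edge or no pair in $T_1\times T_2$ is an edge. Given $\delta,\varepsilon>0$, $G$ is $(\delta,\varepsilon)$-bipartite-rich if for each $i\in\{1,2\}$ and every set $W\subset V_i$ with $|W|\ge\delta|V_i|$, there are at most $|V_{3-i}|^{1/5}$ vertices $v\in V_{3-i}$ such that $|N(v)\cap W|\le\varepsilon|W|$ or $|W\setminus N(v)|<\varepsilon|W|$.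
   Formalization: The parameters $C$ and $\delta$ range over the positive rationals, and the witness $\varepsilon$ is taken in the rationals. -}

module Defs where

open import Data.Bool using (Bool; true; false)
open import Data.Nat as ℕ using (ℕ; _^_)
import Data.Integer as ℤ
open import Data.Integer using (+_)
open import Data.Rational as ℚ using (ℚ; ↥_; ↧ₙ_)
open import Data.Fin using (Fin)
open import Data.Fin.Subset using (Subset; _∈_; _∩_; _─_; ∣_∣)
open import Data.Vec using (tabulate)
open import Data.Product using (Σ; _×_)
open import Data.Sum using (_⊎_)
open import Relation.Binary.PropositionalEquality using (_≡_)
open import Relation.Nullary using (¬_)

BipGraph : ℕ → ℕ → Set
BipGraph n₁ n₂ = Fin n₁ → Fin n₂ → Bool

transpose : ∀ {n₁ n₂} → BipGraph n₁ n₂ → BipGraph n₂ n₁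
transpose E v u = E u v

ℕ→ℚ : ℕ → ℚ
ℕ→ℚ k = (+ k) ℚ./ 1

-- "t ≥ C · log₂ n" for a positive rational C = p/q (p = |↥C|, q = ↧ₙC):
-- t ≥ (p/q) log₂ n  ⇔  q t ≥ p log₂ n  ⇔  n^p ≤ 2^(q t)   (n ≥ 1).
AtLeastClog : ℚ → ℕ → ℕ → Set
AtLeastClog C n t = n ^ ℤ.∣ ↥ C ∣ ℕ.≤ 2 ^ (t ℕ.* ↧ₙ C)

Homogeneous : ∀ {n₁ n₂} → BipGraph n₁ n₂ → Subset n₁ → Subset n₂ → Set
Homogeneous E T₁ T₂ =
  (∀ u v → u ∈ T₁ → v ∈ T₂ → E u v ≡ true) ⊎
  (∀ u v → u ∈ T₁ → v ∈ T₂ → E u v ≡ false)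

BipRamsey : ℚ → ∀ {n₁ n₂} → BipGraph n₁ n₂ → Set
BipRamsey C {n₁} {n₂} E =
  ∀ (t₁ t₂ : ℕ) → AtLeastClog C n₁ t₁ → AtLeastClog C n₂ t₂ →
  ¬ (Σ (Subset n₁) λ T₁ → Σ (Subset n₂) λ T₂ →
       (∣ T₁ ∣ ≡ t₁) × (∣ T₂ ∣ ≡ t₂) × Homogeneous E T₁ T₂)

N : ∀ {n₁ n₂} → BipGraph n₁ n₂ → Fin n₂ → Subset n₁
N E v = tabulate (λ u → E u v)

Bad : ℚ → ∀ {n₁ n₂} → BipGraph n₁ n₂ → Subset n₁ → Fin n₂ → Set
Bad ε E W v =
  (ℕ→ℚ ∣ N E v ∩ W ∣ ℚ.≤ ε ℚ.* ℕ→ℚ ∣ W ∣) ⊎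
  (ℕ→ℚ ∣ W ─ N E v ∣ ℚ.< ε ℚ.* ℕ→ℚ ∣ W ∣)

-- One direction of richness (W ⊆ V₁, counting vertices of V₂):
-- for every W with |W| ≥ δ|V₁|, at most |V₂|^{1/5} bad vertices, i.e.
-- every set S of bad vertices satisfies |S| ≤ |V₂|^{1/5} ⇔ |S|^5 ≤ |V₂|.
RichSide : ℚ → ℚ → ∀ {n₁ n₂} → BipGraph n₁ n₂ → Set
RichSide δ ε {n₁} {n₂} E =
  ∀ (W : Subset n₁) → δ ℚ.* ℕ→ℚ n₁ ℚ.≤ ℕ→ℚ ∣ W ∣ →
  ∀ (S : Subset n₂) → (∀ v → v ∈ S → Bad ε E W v) →
  ∣ S ∣ ^ 5 ℕ.≤ n₂

BipRich : ℚ → ℚ → ∀ {n₁ n₂} → BipGraph n₁ n₂ → Set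
BipRich δ ε E = RichSide δ ε E × RichSide δ ε (transpose E)

-- Choose t_i = M·log_B n_i with B = 2^D, so that t_i ≥ C·log₂ n_i and no t₁ × t₂ pair is
-- homogeneous. Then for a t₁-set A fewer than t₂ vertices are joined to all of A, and fewer than
-- t₂ to none of A, so double counting gives Σ_{v∈S} C(|W ∩ N(v)|, t₁) ≤ t₂·C(|W|, t₁).
-- A bad vertex has a colour class covering a 2M/(2M+1)-fraction of W, and C(h, t) ≥ (s/R)^t·C(n, t)
-- whenever R·h ≥ s·n + R·t; hence there are at most 2·t₂·(1 + 1/(2M))^{t₁} ≤ 2·t₂·n₁^{1/D} bad
-- vertices. The same count for the transposed graph with W = V₂ gives n₁ ≤ 2·4^{t₂}·t₁, so
-- n₁^{1/D} ≤ n₂^{2(k+1)/D + o(1)} for C = (1+k)/(1+q), and D = 10(k+2) makes this o(n₂^{1/5}).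

module Submission where

open import Data.Bool.Base using (Bool; true; false; not; if_then_else_)
open import Data.Bool.Properties using (not-injective)
open import Data.Nat.Base
open import Data.Nat.Properties
open import Data.Nat.Combinatorics using (nC1≡n; nCk+nC[k+1]≡[n+1]C[k+1]) renaming (_C_ to _choose_)
open import Data.Nat.Tactic.RingSolver using (solve-∀)
open import Data.Empty using (⊥-elim)
open import Data.Fin.Base using (Fin; zero; suc)
open import Data.Fin.Subset using (Subset; inside; outside; _∈_; _∉_; _⊆_; _∩_; _─_; ∁; ⊥; ⊤; ∣_∣)
open import Data.Fin.Subset.Properties
  using (∉⊥; ⊥⊆; ∣⊥∣≡0; ∣⊤∣≡n; s⊆s; x∈p∩q⁻; x∈∁p⇒x∉p; ∩-comm)
open import Data.Vec.Base using ([]; _∷_; here; there; tabulate)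
open import Data.Vec.Properties using ([]=⇒lookup; lookup⇒[]=; lookup∘tabulate; tabulate-∘)
open import Data.Product using (Σ; ∃; _×_; _,_; proj₁; proj₂)
open import Data.Sum using (_⊎_; inj₁; inj₂)
import Data.Integer.Base as ℤ
import Data.Integer.Properties as ℤ
import Data.Sign.Base as Sign
open import Data.Nat.Coprimality using (Coprime; 1-coprimeTo)
import Data.Nat.Coprimality as Coprime
open import Data.Rational.Base as ℚ using (ℚ; mkℚ; toℚᵘ; Positive)
import Data.Rational.Properties as ℚ
open import Data.Rational.Unnormalised.Base as ℚᵘ using (ℚᵘ; mkℚᵘ; *≤*; *<*)
import Data.Rational.Unnormalised.Properties as ℚᵘ
open import Relation.Nullary.Decidable using (dec-true)
open import Defs
open import Function.Base using (_∘_)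
open import Relation.Nullary using (¬_; Dec; yes; no; does)
open import Relation.Binary.PropositionalEquality

binomial-absorption : ∀ n k → (suc n choose suc k) * suc k ≡ (n choose k) * suc n
binomial-absorption zero    zero    = refl
binomial-absorption zero    (suc k) = refl
binomial-absorption (suc n) zero    = begin
  (suc (suc n) choose 1) * 1   ≡⟨ *-identityʳ (suc (suc n) choose 1) ⟩
  suc (suc n) choose 1         ≡⟨ nC1≡n (suc (suc n)) ⟩
  suc (suc n)                  ≡⟨ *-identityˡ (suc (suc n)) ⟨
  1 * suc (suc n)              ∎
  where open ≡-Reasoning
binomial-absorption (suc n) (suc k) = begin
  (suc (suc n) choose suc (suc k)) * suc (suc k)
    ≡⟨ cong (_* suc (suc k)) (nCk+nC[k+1]≡[n+1]C[k+1] (suc n) (suc k)) ⟨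
  (a + b) * suc (suc k)
    ≡⟨ e₁ a b k ⟩
  a * suc k + a + b * suc (suc k)
    ≡⟨ cong₂ (λ x y → x + a + y) (binomial-absorption n k) (binomial-absorption n (suc k)) ⟩
  (n choose k) * suc n + a + (n choose suc k) * suc n
    ≡⟨ e₂ (n choose k) (n choose suc k) a n ⟩
  (n choose k + n choose suc k) * suc n + a
    ≡⟨ cong (λ x → x * suc n + a) (nCk+nC[k+1]≡[n+1]C[k+1] n k) ⟩
  a * suc n + a
    ≡⟨ e₃ a (suc n) ⟩
  a * suc (suc n) ∎
  where
  open ≡-Reasoning
  a = suc n choose suc k
  b = suc n choose suc (suc k)
  e₁ : ∀ a b k → (a + b) * suc (suc k) ≡ a * suc k + a + b * suc (suc k)
  e₁ = solve-∀
  e₂ : ∀ x y a n → x * suc n + a + y * suc n ≡ (x + y) * suc n + a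
  e₂ = solve-∀
  e₃ : ∀ a m → a * m + a ≡ a * suc m
  e₃ = solve-∀

binomial-pos : ∀ {n k} → k ≤ n → 0 < n choose k
binomial-pos {n}     {zero}  _         = s≤s z≤n
binomial-pos {suc n} {suc k} (s≤s k≤n) = begin-strict
  0                             <⟨ binomial-pos k≤n ⟩
  n choose k                    ≤⟨ m≤m+n (n choose k) (n choose suc k) ⟩
  n choose k + n choose suc k   ≡⟨ nCk+nC[k+1]≡[n+1]C[k+1] n k ⟩
  suc n choose suc k            ∎
  where open ≤-Reasoning

-- C(h,t)/C(n,t) = ∏_{i<t} (h−i)/(n−i), and each factor is at least s/R because R(h−i) ≥ s(n−i).
binomial-ratio : ∀ s R t n h → s * n + R * t ≤ R * h → s ^ t * (n choose t) ≤ R ^ t * (h choose t)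
binomial-ratio s R zero    n       h       _ = ≤-refl
binomial-ratio s R (suc t) zero    h       _ = ≤-trans (≤-reflexive (*-zeroʳ (s ^ suc t))) z≤n
binomial-ratio s R (suc t) (suc n) zero    c with s
... | zero   = z≤n
... | suc _  with () ← ≤-trans c (≤-reflexive (*-zeroʳ R))
binomial-ratio s R (suc t) (suc n) (suc h) c = *-cancelʳ-≤ _ _ (suc t) (begin
  s ^ suc t * (suc n choose suc t) * suc t     ≡⟨ *-assoc (s ^ suc t) _ (suc t) ⟩
  s ^ suc t * ((suc n choose suc t) * suc t)   ≡⟨ cong (s ^ suc t *_) (binomial-absorption n t) ⟩
  s * s ^ t * ((n choose t) * suc n)           ≡⟨ e₂ s (s ^ t) (n choose t) (suc n) ⟩
  s ^ t * (n choose t) * (s * suc n)           ≤⟨ *-mono-≤ (binomial-ratio s R t n h shifted) (m+n≤o⇒m≤o _ c) ⟩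
  R ^ t * (h choose t) * (R * suc h)           ≡⟨ e₂ R (R ^ t) (h choose t) (suc h) ⟨
  R * R ^ t * ((h choose t) * suc h)           ≡⟨ cong (R ^ suc t *_) (binomial-absorption h t) ⟨
  R ^ suc t * ((suc h choose suc t) * suc t)   ≡⟨ *-assoc (R ^ suc t) _ (suc t) ⟨
  R ^ suc t * (suc h choose suc t) * suc t     ∎)
  where
  open ≤-Reasoning
  e₂ : ∀ s x c n → s * x * (c * n) ≡ x * c * (s * n)
  e₂ = solve-∀
  shifted : s * n + R * t ≤ R * h
  shifted = +-cancelˡ-≤ (s + R) _ _ (begin
    s + R + (s * n + R * t)   ≡⟨ e₁ s R n t ⟩
    s * suc n + R * suc t     ≤⟨ c ⟩
    R * suc h                 ≡⟨ *-suc R h ⟩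
    R + R * h                 ≤⟨ m≤n+m _ s ⟩
    s + (R + R * h)           ≡⟨ +-assoc s R (R * h) ⟨
    s + R + R * h             ∎)
    where
    e₁ : ∀ s R n t → s + R + (s * n + R * t) ≡ s * suc n + R * suc t
    e₁ = solve-∀

[1+N]^k*j≤N^k*N : ∀ N k j → k + j ≡ N → suc N ^ k * j ≤ N ^ k * N
[1+N]^k*j≤N^k*N N zero    j refl = ≤-refl
[1+N]^k*j≤N^k*N N (suc k) j k+j≡N = begin
  suc N * suc N ^ k * j     ≡⟨ e₁ (suc N) (suc N ^ k) j ⟩
  suc N ^ k * (suc N * j)   ≤⟨ *-monoʳ-≤ (suc N ^ k) step ⟩
  suc N ^ k * (N * suc j)   ≡⟨ e₂ (suc N ^ k) N (suc j) ⟩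
  N * (suc N ^ k * suc j)   ≤⟨ *-monoʳ-≤ N ([1+N]^k*j≤N^k*N N k (suc j) (trans (+-suc k j) k+j≡N)) ⟩
  N * (N ^ k * N)           ≡⟨ *-assoc N (N ^ k) N ⟨
  N * N ^ k * N             ∎
  where
  open ≤-Reasoning
  e₁ : ∀ a b c → a * b * c ≡ b * (a * c)
  e₁ = solve-∀
  e₂ : ∀ a b c → a * (b * c) ≡ b * (a * c)
  e₂ = solve-∀
  step : suc N * j ≤ N * suc j
  step = begin
    suc N * j  ≡⟨ *-comm (suc N) j ⟩
    j * suc N  ≡⟨ *-suc j N ⟩
    j + j * N  ≤⟨ +-monoˡ-≤ (j * N) (m≤n+m j (suc k)) ⟩
    suc k + j + j * N  ≡⟨ cong (λ x → x + j * N) k+j≡N ⟩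
    N + j * N  ≡⟨ cong (N +_) (*-comm j N) ⟩
    N + N * j  ≡⟨ *-suc N j ⟨
    N * suc j  ∎

[1+2M]^M≤2*[2M]^M : ∀ M → suc (2 * M) ^ M ≤ 2 * (2 * M) ^ M
[1+2M]^M≤2*[2M]^M zero      = s≤s z≤n
[1+2M]^M≤2*[2M]^M M@(suc _) = *-cancelʳ-≤ _ _ M (begin
  suc (2 * M) ^ M * M     ≤⟨ [1+N]^k*j≤N^k*N (2 * M) M M (e₁ M) ⟩
  (2 * M) ^ M * (2 * M)   ≡⟨ e₂ ((2 * M) ^ M) M ⟩
  2 * (2 * M) ^ M * M     ∎)
  where
  open ≤-Reasoning
  e₁ : ∀ M → M + M ≡ 2 * M
  e₁ = solve-∀
  e₂ : ∀ x M → x * (2 * M) ≡ 2 * x * M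
  e₂ = solve-∀

*-^-distrib : ∀ m n k → (m * n) ^ k ≡ m ^ k * n ^ k
*-^-distrib m n zero    = refl
*-^-distrib m n (suc k) = begin
  m * n * (m * n) ^ k      ≡⟨ cong (m * n *_) (*-^-distrib m n k) ⟩
  m * n * (m ^ k * n ^ k)  ≡⟨ e m n (m ^ k) (n ^ k) ⟩
  m * m ^ k * (n * n ^ k)  ∎
  where
  open ≡-Reasoning
  e : ∀ m n x y → m * n * (x * y) ≡ m * x * (n * y)
  e = solve-∀

[1+2M]^[M*J]≤2^J*[2M]^[M*J] : ∀ M J → suc (2 * M) ^ (M * J) ≤ 2 ^ J * (2 * M) ^ (M * J)
[1+2M]^[M*J]≤2^J*[2M]^[M*J] M J = begin
  suc (2 * M) ^ (M * J)        ≡⟨ ^-*-assoc (suc (2 * M)) M J ⟨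
  (suc (2 * M) ^ M) ^ J        ≤⟨ ^-monoˡ-≤ J ([1+2M]^M≤2*[2M]^M M) ⟩
  (2 * (2 * M) ^ M) ^ J        ≡⟨ *-^-distrib 2 ((2 * M) ^ M) J ⟩
  2 ^ J * ((2 * M) ^ M) ^ J    ≡⟨ cong (2 ^ J *_) (^-*-assoc (2 * M) M J) ⟩
  2 ^ J * (2 * M) ^ (M * J)    ∎
  where open ≤-Reasoning

n<2^n : ∀ n → n < 2 ^ n
n<2^n zero    = s≤s z≤n
n<2^n (suc n) = begin-strict
  suc n          ≤⟨ n<2^n n ⟩
  2 ^ n          <⟨ m<m+n (2 ^ n) (m^n>0 2 n) ⟩
  2 ^ n + 2 ^ n  ≡⟨ cong (2 ^ n +_) (+-identityʳ (2 ^ n)) ⟨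
  2 ^ suc n      ∎
  where open ≤-Reasoning

m*n≤2^[m+n] : ∀ m n → m * n ≤ 2 ^ (m + n)
m*n≤2^[m+n] m n = begin
  m * n            ≤⟨ *-mono-≤ (<⇒≤ (n<2^n m)) (<⇒≤ (n<2^n n)) ⟩
  2 ^ m * 2 ^ n    ≡⟨ ^-distribˡ-+-* 2 m n ⟨
  2 ^ (m + n)      ∎
  where open ≤-Reasoning

^-cancelˡ-≤ : ∀ m {a b} → 1 < m → m ^ a ≤ m ^ b → a ≤ b
^-cancelˡ-≤ m 1<m mᵃ≤mᵇ = ≮⇒≥ (λ b<a → <⇒≱ (^-monoʳ-< m 1<m b<a) mᵃ≤mᵇ)

^-cancelˡ-< : ∀ m {a b} → 1 < m → m ^ a < m ^ b → a < b
^-cancelˡ-< m {a} {b} 1<m mᵃ<mᵇ = ≰⇒> (λ b≤a → <⇒≱ mᵃ<mᵇ (^-monoʳ-≤ m {{>-nonZero (<-trans z<s 1<m)}} b≤a))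

∑-over : ∀ {m} → Subset m → (Fin m → ℕ) → ℕ
∑-over []            f = 0
∑-over (inside  ∷ S) f = f zero + ∑-over S (f ∘ suc)
∑-over (outside ∷ S) f = ∑-over S (f ∘ suc)

syntax ∑-over S (λ v → e) = ∑[ v ∈ S ] e

∑-const : ∀ {m} (S : Subset m) c → ∑[ v ∈ S ] c ≡ ∣ S ∣ * c
∑-const []            c = refl
∑-const (inside  ∷ S) c = cong (c +_) (∑-const S c)
∑-const (outside ∷ S) c = ∑-const S c

∑-cong : ∀ {m} (S : Subset m) {f g : Fin m → ℕ} → (∀ v → f v ≡ g v) → ∑-over S f ≡ ∑-over S g
∑-cong []            f≗g = refl
∑-cong (inside  ∷ S) f≗g = cong₂ _+_ (f≗g zero) (∑-cong S (f≗g ∘ suc))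
∑-cong (outside ∷ S) f≗g = ∑-cong S (f≗g ∘ suc)

∑-mono : ∀ {m} (S : Subset m) {f g : Fin m → ℕ} → (∀ v → v ∈ S → f v ≤ g v) → ∑-over S f ≤ ∑-over S g
∑-mono []            f≤g = z≤n
∑-mono (inside  ∷ S) f≤g = +-mono-≤ (f≤g zero here) (∑-mono S (λ v v∈S → f≤g (suc v) (there v∈S)))
∑-mono (outside ∷ S) f≤g = ∑-mono S (λ v v∈S → f≤g (suc v) (there v∈S))

∑-distrib-+ : ∀ {m} (S : Subset m) (f g : Fin m → ℕ) →
              ∑[ v ∈ S ] (f v + g v) ≡ ∑-over S f + ∑-over S g
∑-distrib-+ []            f g = refl
∑-distrib-+ (inside  ∷ S) f g =
  trans (cong (f zero + g zero +_) (∑-distrib-+ S (f ∘ suc) (g ∘ suc)))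
        (interchange (f zero) (g zero) (∑-over S (f ∘ suc)) (∑-over S (g ∘ suc)))
  where
  interchange : ∀ a b c d → a + b + (c + d) ≡ a + c + (b + d)
  interchange = solve-∀
∑-distrib-+ (outside ∷ S) f g = ∑-distrib-+ S (f ∘ suc) (g ∘ suc)

∑-*ˡ : ∀ {m} (S : Subset m) c (f : Fin m → ℕ) → ∑[ v ∈ S ] (c * f v) ≡ c * ∑-over S f
∑-*ˡ []            c f = sym (*-zeroʳ c)
∑-*ˡ (inside  ∷ S) c f = trans (cong (c * f zero +_) (∑-*ˡ S c (f ∘ suc))) (sym (*-distribˡ-+ c (f zero) _))
∑-*ˡ (outside ∷ S) c f = ∑-*ˡ S c (f ∘ suc)

∑-if : ∀ {m} (S : Subset m) (h : Fin m → Bool) (f : Fin m → ℕ) →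
       ∑[ v ∈ S ] (if h v then f v else 0) ≡ ∑-over (S ∩ tabulate h) f
∑-if []            h f = refl
∑-if (outside ∷ S) h f = ∑-if S (h ∘ suc) (f ∘ suc)
∑-if (inside  ∷ S) h f with h zero
... | true  = cong (f zero +_) (∑-if S (h ∘ suc) (f ∘ suc))
... | false = ∑-if S (h ∘ suc) (f ∘ suc)

∣p∩q∣+∣p∩∁q∣≡∣p∣ : ∀ {n} (p q : Subset n) → ∣ p ∩ q ∣ + ∣ p ∩ ∁ q ∣ ≡ ∣ p ∣
∣p∩q∣+∣p∩∁q∣≡∣p∣ []            []            = refl
∣p∩q∣+∣p∩∁q∣≡∣p∣ (outside ∷ p) (_       ∷ q) = ∣p∩q∣+∣p∩∁q∣≡∣p∣ p q
∣p∩q∣+∣p∩∁q∣≡∣p∣ (inside  ∷ p) (inside  ∷ q) = cong suc (∣p∩q∣+∣p∩∁q∣≡∣p∣ p q)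
∣p∩q∣+∣p∩∁q∣≡∣p∣ (inside  ∷ p) (outside ∷ q) = trans (+-suc _ _) (cong suc (∣p∩q∣+∣p∩∁q∣≡∣p∣ p q))

p─q≡p∩∁q : ∀ {n} (p q : Subset n) → p ─ q ≡ p ∩ ∁ q
p─q≡p∩∁q []            []            = refl
p─q≡p∩∁q (outside ∷ p) (inside  ∷ q) = cong (outside ∷_) (p─q≡p∩∁q p q)
p─q≡p∩∁q (outside ∷ p) (outside ∷ q) = cong (outside ∷_) (p─q≡p∩∁q p q)
p─q≡p∩∁q (inside  ∷ p) (inside  ∷ q) = cong (outside ∷_) (p─q≡p∩∁q p q)
p─q≡p∩∁q (inside  ∷ p) (outside ∷ q) = cong (inside ∷_) (p─q≡p∩∁q p q)

∈-tabulate⁻ : ∀ {n} {f : Fin n → Bool} {v} → v ∈ tabulate f → f v ≡ true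
∈-tabulate⁻ {f = f} {v} v∈ = trans (sym (lookup∘tabulate f v)) ([]=⇒lookup v∈)

∈-tabulate⁺ : ∀ {n} {f : Fin n → Bool} {v} → f v ≡ true → v ∈ tabulate f
∈-tabulate⁺ {f = f} {v} fv≡true = lookup⇒[]= v (tabulate f) (trans (lookup∘tabulate f v) fv≡true)

∃⊆-of-size : ∀ {n} (p : Subset n) t → t ≤ ∣ p ∣ → ∃ λ q → q ⊆ p × ∣ q ∣ ≡ t
∃⊆-of-size {n} p       zero    _       = ⊥ , ⊥⊆ , ∣⊥∣≡0 n
∃⊆-of-size (inside  ∷ p) (suc t) (s≤s t≤∣p∣) with ∃⊆-of-size p t t≤∣p∣
... | q , q⊆p , ∣q∣≡t = inside ∷ q , s⊆s q⊆p , cong suc ∣q∣≡t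
∃⊆-of-size (outside ∷ p) (suc t) t<∣p∣ with ∃⊆-of-size p (suc t) t<∣p∣
... | q , q⊆p , ∣q∣≡t = outside ∷ q , s⊆s q⊆p , ∣q∣≡t

complement : ∀ {n₁ n₂} → BipGraph n₁ n₂ → BipGraph n₁ n₂
complement E u v = not (E u v)

N-complement : ∀ {n₁ n₂} (E : BipGraph n₁ n₂) v → N (complement E) v ≡ ∁ (N E v)
N-complement E v = tabulate-∘ not (λ u → E u v)

Complete : ∀ {n₁ n₂} → BipGraph n₁ n₂ → Subset n₁ → Subset n₂ → Set
Complete G A T = ∀ u v → u ∈ A → v ∈ T → G u v ≡ true

KFree : ∀ {n₁ n₂} → BipGraph n₁ n₂ → ℕ → ℕ → Set
KFree G t₁ t₂ = ∀ A T → ∣ A ∣ ≡ t₁ → ∣ T ∣ ≡ t₂ → ¬ Complete G A T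

KFree⇒∣T∣<t₂ : ∀ {n₁ n₂} {G : BipGraph n₁ n₂} {t₁ t₂} A T →
               KFree G t₁ t₂ → ∣ A ∣ ≡ t₁ → Complete G A T → ∣ T ∣ < t₂
KFree⇒∣T∣<t₂ {t₂ = t₂} A T free ∣A∣≡t₁ A×T⊆G = ≰⇒> λ t₂≤∣T∣ →
  let (T′ , T′⊆T , ∣T′∣≡t₂) = ∃⊆-of-size T t₂ t₂≤∣T∣
  in free A T′ ∣A∣≡t₁ ∣T′∣≡t₂ (λ u v u∈A v∈T′ → A×T⊆G u v u∈A (T′⊆T v∈T′))

NoHomogeneous : ∀ {n₁ n₂} → BipGraph n₁ n₂ → ℕ → ℕ → Set
NoHomogeneous E t₁ t₂ = KFree E t₁ t₂ × KFree (complement E) t₁ t₂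

KFree-transpose : ∀ {n₁ n₂} {G : BipGraph n₁ n₂} {t₁ t₂} → KFree G t₁ t₂ → KFree (transpose G) t₂ t₁
KFree-transpose free T A ∣T∣≡t₂ ∣A∣≡t₁ T×A⊆Gᵀ = free A T ∣A∣≡t₁ ∣T∣≡t₂ λ u v u∈A v∈T → T×A⊆Gᵀ v u v∈T u∈A

NoHomogeneous-transpose : ∀ {n₁ n₂} {E : BipGraph n₁ n₂} {t₁ t₂} →
                          NoHomogeneous E t₁ t₂ → NoHomogeneous (transpose E) t₂ t₁
NoHomogeneous-transpose (free , free̅) = KFree-transpose free , KFree-transpose free̅

BipRamsey⇒NoHomogeneous : ∀ {c n₁ n₂} {E : BipGraph n₁ n₂} {t₁ t₂} → BipRamsey c E →
  AtLeastClog c n₁ t₁ → AtLeastClog c n₂ t₂ → NoHomogeneous E t₁ t₂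
BipRamsey⇒NoHomogeneous {t₁ = t₁} {t₂} ramsey t₁-large t₂-large =
  (λ A T ∣A∣≡t₁ ∣T∣≡t₂ A×T⊆E →
     ramsey t₁ t₂ t₁-large t₂-large (A , T , ∣A∣≡t₁ , ∣T∣≡t₂ , inj₁ A×T⊆E)) ,
  (λ A T ∣A∣≡t₁ ∣T∣≡t₂ A×T⊆E̅ →
     ramsey t₁ t₂ t₁-large t₂-large (A , T , ∣A∣≡t₁ , ∣T∣≡t₂ , inj₂ λ u v u∈A v∈T → not-injective (A×T⊆E̅ u v u∈A v∈T)))

binomial-cons : ∀ {n} b (p : Subset n) t →
                ∣ b ∷ p ∣ choose suc t ≡ (∣ p ∣ choose suc t) + (if b then ∣ p ∣ choose t else 0)
binomial-cons inside  p t = trans (sym (nCk+nC[k+1]≡[n+1]C[k+1] ∣ p ∣ t)) (+-comm (∣ p ∣ choose t) _)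
binomial-cons outside p t = sym (+-identityʳ _)

Complete-outside : ∀ {n m} {G : BipGraph (suc n) m} {A T} →
                   Complete (G ∘ suc) A T → Complete G (outside ∷ A) T
Complete-outside A×T⊆G (suc u) v (there u∈A) v∈T = A×T⊆G u v u∈A v∈T

Complete-inside : ∀ {n m} {G : BipGraph (suc n) m} {A T} →
                  T ⊆ N (transpose G) zero → Complete (G ∘ suc) A T → Complete G (inside ∷ A) T
Complete-inside T⊆N₀ A×T⊆G zero    v here        v∈T = ∈-tabulate⁻ (T⊆N₀ v∈T)
Complete-inside T⊆N₀ A×T⊆G (suc u) v (there u∈A) v∈T = A×T⊆G u v u∈A v∈T

-- Counts the pairs (A, v) with v ∈ S and A a t-subset of W ∩ N(v) in two ways (Kővári–Sós–Turán).
double-counting : ∀ {n m} (G : BipGraph n m) (W : Subset n) (S : Subset m) t k →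
  (∀ A T → ∣ A ∣ ≡ t → T ⊆ S → Complete G A T → ∣ T ∣ ≤ k) →
  ∑[ v ∈ S ] (∣ W ∩ N G v ∣ choose t) ≤ (∣ W ∣ choose t) * k
double-counting {n} G W S zero k few = begin
  ∑[ v ∈ S ] 1   ≡⟨ ∑-const S 1 ⟩
  ∣ S ∣ * 1      ≡⟨ *-identityʳ ∣ S ∣ ⟩
  ∣ S ∣          ≤⟨ few ⊥ S (∣⊥∣≡0 n) (λ v∈S → v∈S) (λ u v u∈⊥ _ → ⊥-elim (∉⊥ u∈⊥)) ⟩
  k              ≡⟨ *-identityˡ k ⟨
  1 * k          ∎
  where open ≤-Reasoning
double-counting G [] S (suc t) k few = ≤-trans (≤-reflexive (trans (∑-const S 0) (*-zeroʳ ∣ S ∣))) z≤n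
double-counting G (outside ∷ W) S (suc t) k few =
  double-counting (G ∘ suc) W S (suc t) k λ A T ∣A∣≡1+t T⊆S A×T⊆G →
    few (outside ∷ A) T ∣A∣≡1+t T⊆S (Complete-outside A×T⊆G)
double-counting G (inside ∷ W) S (suc t) k few = begin
  ∑[ v ∈ S ] (∣ G zero v ∷ nbr v ∣ choose suc t)
    ≡⟨ ∑-cong S (λ v → binomial-cons (G zero v) (nbr v) t) ⟩
  ∑[ v ∈ S ] ((∣ nbr v ∣ choose suc t) + (if G zero v then ∣ nbr v ∣ choose t else 0))
    ≡⟨ ∑-distrib-+ S _ _ ⟩
  ∑[ v ∈ S ] (∣ nbr v ∣ choose suc t) + ∑[ v ∈ S ] (if G zero v then ∣ nbr v ∣ choose t else 0)
    ≡⟨ cong (∑[ v ∈ S ] (∣ nbr v ∣ choose suc t) +_) (∑-if S (G zero) _) ⟩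
  ∑[ v ∈ S ] (∣ nbr v ∣ choose suc t) + ∑[ v ∈ S ∩ N₀ ] (∣ nbr v ∣ choose t)
    ≤⟨ +-mono-≤ (double-counting (G ∘ suc) W S (suc t) k few-without-0)
                (double-counting (G ∘ suc) W (S ∩ N₀) t k few-with-0) ⟩
  (∣ W ∣ choose suc t) * k + (∣ W ∣ choose t) * k
    ≡⟨ *-distribʳ-+ k (∣ W ∣ choose suc t) (∣ W ∣ choose t) ⟨
  ((∣ W ∣ choose suc t) + (∣ W ∣ choose t)) * k
    ≡⟨ cong (_* k) (trans (+-comm (∣ W ∣ choose suc t) _) (nCk+nC[k+1]≡[n+1]C[k+1] ∣ W ∣ t)) ⟩
  (suc ∣ W ∣ choose suc t) * k ∎
  where
  open ≤-Reasoning
  nbr : Fin _ → Subset _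
  nbr v = W ∩ N (G ∘ suc) v
  N₀ : Subset _
  N₀ = N (transpose G) zero
  few-without-0 : ∀ A T → ∣ A ∣ ≡ suc t → T ⊆ S → Complete (G ∘ suc) A T → ∣ T ∣ ≤ k
  few-without-0 A T ∣A∣≡1+t T⊆S A×T⊆G = few (outside ∷ A) T ∣A∣≡1+t T⊆S (Complete-outside A×T⊆G)
  few-with-0 : ∀ A T → ∣ A ∣ ≡ t → T ⊆ S ∩ N₀ → Complete (G ∘ suc) A T → ∣ T ∣ ≤ k
  few-with-0 A T ∣A∣≡t T⊆S∩N₀ A×T⊆G =
    few (inside ∷ A) T (cong suc ∣A∣≡t) (proj₁ ∘ x∈p∩q⁻ S N₀ ∘ T⊆S∩N₀)
      (Complete-inside (proj₂ ∘ x∈p∩q⁻ S N₀ ∘ T⊆S∩N₀) A×T⊆G)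

Dense : ∀ {n₁ n₂} → ℕ → ℕ → ℕ → BipGraph n₁ n₂ → Subset n₁ → Fin n₂ → Set
Dense s R t G W v = s * ∣ W ∣ + R * t ≤ R * ∣ W ∩ N G v ∣

few-dense-vertices : ∀ {n₁ n₂} {G : BipGraph n₁ n₂} {t₁ t₂} s R (W : Subset n₁) (S : Subset n₂) →
  KFree G t₁ t₂ → t₁ ≤ ∣ W ∣ → (∀ v → v ∈ S → Dense s R t₁ G W v) → ∣ S ∣ * s ^ t₁ ≤ R ^ t₁ * t₂
few-dense-vertices {G = G} {t₁} {t₂} s R W S free t₁≤∣W∣ dense =
  *-cancelʳ-≤ _ _ (∣ W ∣ choose t₁) {{>-nonZero (binomial-pos t₁≤∣W∣)}} (begin
    ∣ S ∣ * s ^ t₁ * (∣ W ∣ choose t₁)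
      ≡⟨ *-assoc ∣ S ∣ (s ^ t₁) _ ⟩
    ∣ S ∣ * (s ^ t₁ * (∣ W ∣ choose t₁))
      ≡⟨ ∑-const S _ ⟨
    ∑[ v ∈ S ] (s ^ t₁ * (∣ W ∣ choose t₁))
      ≤⟨ ∑-mono S (λ v v∈S → binomial-ratio s R t₁ ∣ W ∣ _ (dense v v∈S)) ⟩
    ∑[ v ∈ S ] (R ^ t₁ * (∣ W ∩ N G v ∣ choose t₁))
      ≡⟨ ∑-*ˡ S (R ^ t₁) _ ⟩
    R ^ t₁ * ∑[ v ∈ S ] (∣ W ∩ N G v ∣ choose t₁)
      ≤⟨ *-monoʳ-≤ (R ^ t₁) (double-counting G W S t₁ t₂ few) ⟩
    R ^ t₁ * ((∣ W ∣ choose t₁) * t₂)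
      ≡⟨ e (R ^ t₁) (∣ W ∣ choose t₁) t₂ ⟩
    R ^ t₁ * t₂ * (∣ W ∣ choose t₁)
      ∎)
  where
  open ≤-Reasoning
  few : ∀ A T → ∣ A ∣ ≡ t₁ → T ⊆ S → Complete G A T → ∣ T ∣ ≤ t₂
  few A T ∣A∣≡t₁ _ A×T⊆G = <⇒≤ (KFree⇒∣T∣<t₂ A T free ∣A∣≡t₁ A×T⊆G)
  e : ∀ x y z → x * (y * z) ≡ x * z * y
  e = solve-∀

∈-tabulate-does⁻ : ∀ {n} {P : Fin n → Set} (P? : ∀ v → Dec (P v)) {v} → v ∈ tabulate (does ∘ P?) → P v
∈-tabulate-does⁻ P? {v} v∈ with P? v | ∈-tabulate⁻ v∈
... | yes Pv | _ = Pv

∉-tabulate-does⁻ : ∀ {n} {P : Fin n → Set} (P? : ∀ v → Dec (P v)) {v} → v ∉ tabulate (does ∘ P?) → ¬ P v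
∉-tabulate-does⁻ P? {v} v∉ Pv = v∉ (∈-tabulate⁺ (dec-true (P? v) Pv))

few-dense-vertices-in-either-colour :
  ∀ {n₁ n₂} {E : BipGraph n₁ n₂} {t₁ t₂} s R (W : Subset n₁) (S : Subset n₂) →
  NoHomogeneous E t₁ t₂ → t₁ ≤ ∣ W ∣ →
  (∀ v → v ∈ S → Dense s R t₁ E W v ⊎ Dense s R t₁ (complement E) W v) →
  ∣ S ∣ * s ^ t₁ ≤ 2 * (R ^ t₁ * t₂)
few-dense-vertices-in-either-colour {E = E} {t₁} {t₂} s R W S (free , free̅) t₁≤∣W∣ dense = begin
  ∣ S ∣ * s ^ t₁                                  ≡⟨ cong (_* s ^ t₁) (∣p∩q∣+∣p∩∁q∣≡∣p∣ S D) ⟨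
  (∣ S ∩ D ∣ + ∣ S ∩ ∁ D ∣) * s ^ t₁              ≡⟨ *-distribʳ-+ (s ^ t₁) ∣ S ∩ D ∣ _ ⟩
  ∣ S ∩ D ∣ * s ^ t₁ + ∣ S ∩ ∁ D ∣ * s ^ t₁      ≤⟨ +-mono-≤ (few-dense-vertices s R W (S ∩ D) free t₁≤∣W∣ dense-E)
                                                              (few-dense-vertices s R W (S ∩ ∁ D) free̅ t₁≤∣W∣ dense-E̅) ⟩
  R ^ t₁ * t₂ + R ^ t₁ * t₂                       ≡⟨ cong (R ^ t₁ * t₂ +_) (+-identityʳ _) ⟨
  2 * (R ^ t₁ * t₂)                               ∎
  where
  open ≤-Reasoning
  dense? : ∀ v → Dec (Dense s R t₁ E W v)
  dense? v = _ ≤? _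
  D : Subset _
  D = tabulate (does ∘ dense?)
  dense-E : ∀ v → v ∈ S ∩ D → Dense s R t₁ E W v
  dense-E v v∈S∩D = ∈-tabulate-does⁻ dense? (proj₂ (x∈p∩q⁻ S D v∈S∩D))
  dense-E̅ : ∀ v → v ∈ S ∩ ∁ D → Dense s R t₁ (complement E) W v
  dense-E̅ v v∈S∩∁D with x∈p∩q⁻ S (∁ D) v∈S∩∁D
  ... | v∈S , v∈∁D with dense v v∈S
  ...   | inj₂ dense̅ = dense̅
  ...   | inj₁ dense′ = ⊥-elim (∉-tabulate-does⁻ dense? (x∈∁p⇒x∉p v∈∁D) dense′)

degree-partition : ∀ {n₁ n₂} (E : BipGraph n₁ n₂) (W : Subset n₁) v →
                   ∣ W ∩ N E v ∣ + ∣ W ∩ N (complement E) v ∣ ≡ ∣ W ∣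
degree-partition E W v = begin
  ∣ W ∩ N E v ∣ + ∣ W ∩ N (complement E) v ∣  ≡⟨ cong (λ p → ∣ W ∩ N E v ∣ + ∣ W ∩ p ∣) (N-complement E v) ⟩
  ∣ W ∩ N E v ∣ + ∣ W ∩ ∁ (N E v) ∣           ≡⟨ ∣p∩q∣+∣p∩∁q∣≡∣p∣ W (N E v) ⟩
  ∣ W ∣                                       ∎
  where open ≡-Reasoning

∣W─N∣≡∣W∩N̅∣ : ∀ {n₁ n₂} (E : BipGraph n₁ n₂) (W : Subset n₁) v →
              ∣ W ─ N E v ∣ ≡ ∣ W ∩ N (complement E) v ∣
∣W─N∣≡∣W∩N̅∣ E W v = cong ∣_∣ (trans (p─q≡p∩∁q W (N E v)) (cong (W ∩_) (sym (N-complement E v))))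

x+y≡n⇒n≤2x⊎n≤2y : ∀ x y {n} → x + y ≡ n → n ≤ 2 * x ⊎ n ≤ 2 * y
x+y≡n⇒n≤2x⊎n≤2y x y refl with ≤-total x y
... | inj₁ x≤y = inj₂ (≤-trans (+-monoˡ-≤ y x≤y) (≤-reflexive (cong (y +_) (sym (+-identityʳ y)))))
... | inj₂ y≤x = inj₁ (≤-trans (+-monoʳ-≤ x y≤x) (≤-reflexive (cong (x +_) (sym (+-identityʳ x)))))

-- Every vertex of V₂ has a colour class covering half of V₁.
n₂≤2*4^t₁*t₂ : ∀ {n₁ n₂} (E : BipGraph n₁ n₂) {t₁ t₂} →
               NoHomogeneous E t₁ t₂ → 4 * t₁ ≤ n₁ → n₂ ≤ 2 * (4 ^ t₁ * t₂)
n₂≤2*4^t₁*t₂ {n₁} {n₂} E {t₁} {t₂} no-hom 4t₁≤n₁ = begin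
  n₂                  ≡⟨ ∣⊤∣≡n n₂ ⟨
  ∣ V₂ ∣              ≡⟨ trans (cong (∣ V₂ ∣ *_) (^-zeroˡ t₁)) (*-identityʳ ∣ V₂ ∣) ⟨
  ∣ V₂ ∣ * 1 ^ t₁     ≤⟨ few-dense-vertices-in-either-colour 1 4 V₁ V₂ no-hom t₁≤∣V₁∣ half-dense ⟩
  2 * (4 ^ t₁ * t₂)   ∎
  where
  open ≤-Reasoning
  V₁ : Subset n₁
  V₁ = ⊤
  V₂ : Subset n₂
  V₂ = ⊤
  4t₁≤∣V₁∣ : 4 * t₁ ≤ ∣ V₁ ∣
  4t₁≤∣V₁∣ = ≤-trans 4t₁≤n₁ (≤-reflexive (sym (∣⊤∣≡n n₁)))
  t₁≤∣V₁∣ : t₁ ≤ ∣ V₁ ∣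
  t₁≤∣V₁∣ = ≤-trans (m≤n*m t₁ 4) 4t₁≤∣V₁∣
  dense : ∀ x → ∣ V₁ ∣ ≤ 2 * x → 1 * ∣ V₁ ∣ + 4 * t₁ ≤ 4 * x
  dense x ∣V₁∣≤2x = begin
    1 * ∣ V₁ ∣ + 4 * t₁  ≤⟨ +-mono-≤ (≤-reflexive (*-identityˡ ∣ V₁ ∣)) 4t₁≤∣V₁∣ ⟩
    ∣ V₁ ∣ + ∣ V₁ ∣      ≤⟨ +-mono-≤ ∣V₁∣≤2x ∣V₁∣≤2x ⟩
    2 * x + 2 * x        ≡⟨ e x ⟩
    4 * x                ∎
    where
    e : ∀ x → 2 * x + 2 * x ≡ 4 * x
    e = solve-∀
  half-dense : ∀ v → v ∈ V₂ → Dense 1 4 t₁ E V₁ v ⊎ Dense 1 4 t₁ (complement E) V₁ v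
  half-dense v _ with x+y≡n⇒n≤2x⊎n≤2y ∣ V₁ ∩ N E v ∣ ∣ V₁ ∩ N (complement E) v ∣ (degree-partition E V₁ v)
  ... | inj₁ ∣V₁∣≤2x = inj₁ (dense ∣ V₁ ∩ N E v ∣ ∣V₁∣≤2x)
  ... | inj₂ ∣V₁∣≤2y = inj₂ (dense ∣ V₁ ∩ N (complement E) v ∣ ∣V₁∣≤2y)

-- From x + y = w and x ≤ w/(2(s+1)): (s+1)·y ≥ s·w + w/2 ≥ s·w + (s+1)·t.
sparse⇒co-dense : ∀ s {x y w t} → x + y ≡ w → 2 * suc s * x ≤ w → 2 * suc s * t ≤ w →
                  s * w + suc s * t ≤ suc s * y
sparse⇒co-dense s {x} {y} {w} {t} x+y≡w 2Rx≤w 2Rt≤w = *-cancelˡ-≤ 2 (+-cancelˡ-≤ w _ _ (begin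
  w + 2 * (s * w + R * t)    ≡⟨ e₁ s w t ⟩
  2 * s * w + w + 2 * R * t  ≤⟨ +-monoʳ-≤ (2 * s * w + w) 2Rt≤w ⟩
  2 * s * w + w + w          ≡⟨ e₂ s w ⟩
  2 * R * w                  ≡⟨ cong (2 * R *_) x+y≡w ⟨
  2 * R * (x + y)            ≡⟨ *-distribˡ-+ (2 * R) x y ⟩
  2 * R * x + 2 * R * y      ≤⟨ +-monoˡ-≤ (2 * R * y) 2Rx≤w ⟩
  w + 2 * R * y              ≡⟨ cong (w +_) (*-assoc 2 R y) ⟩
  w + 2 * (R * y)            ∎))
  where
  open ≤-Reasoning
  R = suc s
  e₁ : ∀ s w t → w + 2 * (s * w + suc s * t) ≡ 2 * s * w + w + 2 * suc s * t
  e₁ = solve-∀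
  e₂ : ∀ s w → 2 * s * w + w + w ≡ 2 * suc s * w
  e₂ = solve-∀

-- A lopsided vertex is dense, with ratio 2M/(2M+1), in the other colour, and (1 + 1/(2M))^{MJ} ≤ 2^J.
few-lopsided-vertices : ∀ {n₁ n₂} {E : BipGraph n₁ n₂} M .{{_ : NonZero M}} J {t₂} (W : Subset n₁) (S : Subset n₂) →
  NoHomogeneous E (M * J) t₂ → 2 * suc (2 * M) * (M * J) ≤ ∣ W ∣ →
  (∀ v → v ∈ S → 2 * suc (2 * M) * ∣ W ∩ N E v ∣ ≤ ∣ W ∣ ⊎ 2 * suc (2 * M) * ∣ W ─ N E v ∣ ≤ ∣ W ∣) →
  ∣ S ∣ ≤ 2 * (2 ^ J * t₂)
few-lopsided-vertices {E = E} M J {t₂} W S no-hom large lopsided =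
  *-cancelʳ-≤ _ _ ((2 * M) ^ t) {{m^n≢0 (2 * M) t {{m*n≢0 2 M}}}} (begin
    ∣ S ∣ * (2 * M) ^ t              ≤⟨ few-dense-vertices-in-either-colour (2 * M) (suc (2 * M)) W S
                                           no-hom (≤-trans (m≤n*m t (2 * suc (2 * M))) large) dense ⟩
    2 * (suc (2 * M) ^ t * t₂)       ≤⟨ *-monoʳ-≤ 2 (*-monoˡ-≤ t₂ ([1+2M]^[M*J]≤2^J*[2M]^[M*J] M J)) ⟩
    2 * (2 ^ J * (2 * M) ^ t * t₂)   ≡⟨ e (2 ^ J) ((2 * M) ^ t) t₂ ⟩
    2 * (2 ^ J * t₂) * (2 * M) ^ t   ∎)
  where
  open ≤-Reasoning
  t = M * J
  e : ∀ x y z → 2 * (x * y * z) ≡ 2 * (x * z) * y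
  e = solve-∀
  dense : ∀ v → v ∈ S → Dense (2 * M) (suc (2 * M)) t E W v ⊎ Dense (2 * M) (suc (2 * M)) t (complement E) W v
  dense v v∈S with lopsided v v∈S
  ... | inj₁ sparse = inj₂ (sparse⇒co-dense (2 * M) (degree-partition E W v) sparse large)
  ... | inj₂ co-sparse = inj₁ (sparse⇒co-dense (2 * M)
          (trans (+-comm ∣ W ∩ N (complement E) v ∣ ∣ W ∩ N E v ∣) (degree-partition E W v))
          (subst (λ x → 2 * suc (2 * M) * x ≤ ∣ W ∣) (∣W─N∣≡∣W∩N̅∣ E W v) co-sparse) large)

log-bracket : ∀ B → 1 < B → ∀ n .{{_ : NonZero n}} → ∃ λ J → n ≤ B ^ J × B ^ J ≤ B * n
log-bracket B 1<B 1 = 0 , ≤-refl , ≤-trans (<⇒≤ 1<B) (≤-reflexive (sym (*-identityʳ B)))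
log-bracket B 1<B (suc (suc m)) with log-bracket B 1<B (suc m)
... | J , 1+m≤Bᴶ , Bᴶ≤B[1+m] with suc (suc m) ≤? B ^ J
...   | yes 2+m≤Bᴶ = J , 2+m≤Bᴶ , ≤-trans Bᴶ≤B[1+m] (*-monoʳ-≤ B (n≤1+n (suc m)))
...   | no  2+m≰Bᴶ = suc J , 2+m≤B*Bᴶ , *-monoʳ-≤ B (≤-trans (≤-pred (≰⇒> 2+m≰Bᴶ)) (n≤1+n (suc m)))
  where
  open ≤-Reasoning
  2+m≤B*Bᴶ : suc (suc m) ≤ B * B ^ J
  2+m≤B*Bᴶ = begin
    suc (suc m)      ≤⟨ s≤s 1+m≤Bᴶ ⟩
    suc (B ^ J)      ≤⟨ +-monoˡ-≤ (B ^ J) (m^n>0 B {{>-nonZero (<-trans z<s 1<B)}} J) ⟩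
    B ^ J + B ^ J    ≡⟨ cong (B ^ J +_) (+-identityʳ (B ^ J)) ⟨
    2 * B ^ J        ≤⟨ *-monoˡ-≤ (B ^ J) 1<B ⟩
    B * B ^ J        ∎

G*[M*J]≤n : ∀ D G M J n → 2 ≤ D → (2 ^ D) ^ J ≤ 2 ^ D * n → G * M + 2 ≤ J → G * (M * J) ≤ n
G*[M*J]≤n D G M zero    n 2≤D _ GM+2≤0 with () ← ≤-trans (m≤n+m 2 (G * M)) GM+2≤0
G*[M*J]≤n D G M (suc J) n 2≤D Bᴶ⁺¹≤Bn GM+2≤1+J = begin
  G * (M * suc J)        ≡⟨ *-assoc G M (suc J) ⟨
  G * M * suc J          ≤⟨ m*n≤2^[m+n] (G * M) (suc J) ⟩
  2 ^ (G * M + suc J)    ≤⟨ ^-monoʳ-≤ 2 exponent ⟩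
  2 ^ (D * J)            ≡⟨ ^-*-assoc 2 D J ⟨
  (2 ^ D) ^ J            ≤⟨ *-cancelˡ-≤ (2 ^ D) {{m^n≢0 2 D}} Bᴶ⁺¹≤Bn ⟩
  n                      ∎
  where
  open ≤-Reasoning
  exponent : G * M + suc J ≤ D * J
  exponent = begin
    G * M + suc J   ≡⟨ +-suc (G * M) J ⟩
    suc (G * M) + J ≤⟨ +-monoˡ-≤ J (≤-pred (subst (_≤ suc J) (+-comm (G * M) 2) GM+2≤1+J)) ⟩
    J + J           ≡⟨ cong (J +_) (+-identityʳ J) ⟨
    2 * J           ≤⟨ *-monoˡ-≤ J 2≤D ⟩
    D * J           ∎

log₂-≤ : ∀ D J x e → (2 ^ D) ^ J ≤ 2 ^ D * x → x ≤ 2 ^ e → D * J ≤ D + e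
log₂-≤ D J x e Bᴶ≤Bx x≤2ᵉ = ^-cancelˡ-≤ 2 (s≤s (s≤s z≤n)) (begin
  2 ^ (D * J)     ≡⟨ ^-*-assoc 2 D J ⟨
  (2 ^ D) ^ J     ≤⟨ Bᴶ≤Bx ⟩
  2 ^ D * x       ≤⟨ *-monoʳ-≤ (2 ^ D) x≤2ᵉ ⟩
  2 ^ D * 2 ^ e   ≡⟨ ^-distribˡ-+-* 2 D e ⟨
  2 ^ (D + e)     ∎)
  where open ≤-Reasoning

log₂-< : ∀ D J x e → (2 ^ D) ^ J ≤ 2 ^ D * x → x < 2 ^ e → D * J < D + e
log₂-< D J x e Bᴶ≤Bx x<2ᵉ = ^-cancelˡ-< 2 (s≤s (s≤s z≤n)) (begin-strict
  2 ^ (D * J)     ≡⟨ ^-*-assoc 2 D J ⟨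
  (2 ^ D) ^ J     ≤⟨ Bᴶ≤Bx ⟩
  2 ^ D * x       <⟨ *-monoʳ-< (2 ^ D) {{m^n≢0 2 D}} x<2ᵉ ⟩
  2 ^ D * 2 ^ e   ≡⟨ ^-distribˡ-+-* 2 D e ⟨
  2 ^ (D + e)     ∎)
  where open ≤-Reasoning

2*[2^a*[b*c]]≤2^[1+[a+[b+c]]] : ∀ a b c → 2 * (2 ^ a * (b * c)) ≤ 2 ^ (1 + (a + (b + c)))
2*[2^a*[b*c]]≤2^[1+[a+[b+c]]] a b c = begin
  2 * (2 ^ a * (b * c))        ≤⟨ *-monoʳ-≤ 2 (*-monoʳ-≤ (2 ^ a) (m*n≤2^[m+n] b c)) ⟩
  2 * (2 ^ a * 2 ^ (b + c))    ≡⟨ cong (2 *_) (^-distribˡ-+-* 2 a (b + c)) ⟨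
  2 ^ (1 + (a + (b + c)))      ∎
  where open ≤-Reasoning

-- Eliminates x from a·x ≤ b·y + c and d·y < e·x + f when e·b < a·d.
y<e*c+a*f : ∀ a b c d e f x y → a * x ≤ b * y + c → d * y < e * x + f → e * b < a * d → y < e * c + a * f
y<e*c+a*f a b c d e f x y ax≤by+c dy<ex+f eb<ad = +-cancelˡ-< (e * b * y) _ _ (begin-strict
  e * b * y + y          ≡⟨ +-comm (e * b * y) y ⟩
  suc (e * b) * y        ≤⟨ *-monoˡ-≤ y eb<ad ⟩
  a * d * y              ≡⟨ *-assoc a d y ⟩
  a * (d * y)            <⟨ *-monoʳ-< a {{a≢0}} dy<ex+f ⟩
  a * (e * x + f)        ≡⟨ e₁ a e x f ⟩
  e * (a * x) + a * f    ≤⟨ +-monoˡ-≤ (a * f) (*-monoʳ-≤ e ax≤by+c) ⟩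
  e * (b * y + c) + a * f ≡⟨ e₂ e b y c (a * f) ⟩
  e * b * y + (e * c + a * f) ∎)
  where
  open ≤-Reasoning
  a≢0 : NonZero a
  a≢0 = m*n≢0⇒m≢0 a {{>-nonZero (≤-trans (s≤s z≤n) eb<ad)}}
  e₁ : ∀ a e x f → a * (e * x + f) ≡ e * (a * x) + a * f
  e₁ = solve-∀
  e₂ : ∀ e b y c g → e * (b * y + c) + g ≡ e * b * y + (e * c + g)
  e₂ = solve-∀

ℕ→ℚ≡mkℚ : ∀ x → ℕ→ℚ x ≡ mkℚ (ℤ.+ x) 0 (Coprime.sym (1-coprimeTo x))
ℕ→ℚ≡mkℚ x = ℚ.normalize-coprime (Coprime.sym (1-coprimeTo x))

-- For r = n/(1+d) in lowest terms, comparisons between ℕ→ℚ x and r·ℕ→ℚ w are read off in ℕ.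
module _ (n d : ℕ) .(c : Coprime n (suc d)) where

  private
    r : ℚ
    r = mkℚ (ℤ.+ n) d c

    ℕᵘ : ℕ → ℚᵘ
    ℕᵘ x = mkℚᵘ (ℤ.+ x) 0

    toℚᵘ-ℕ→ℚ : ∀ x → toℚᵘ (ℕ→ℚ x) ℚᵘ.≃ ℕᵘ x
    toℚᵘ-ℕ→ℚ x = ℚᵘ.≃-reflexive (cong toℚᵘ (ℕ→ℚ≡mkℚ x))

    toℚᵘ-r*ℕ→ℚ : ∀ w → toℚᵘ (r ℚ.* ℕ→ℚ w) ℚᵘ.≃ toℚᵘ r ℚᵘ.* ℕᵘ w
    toℚᵘ-r*ℕ→ℚ w = ℚᵘ.≃-trans (ℚ.toℚᵘ-homo-* r (ℕ→ℚ w)) (ℚᵘ.*-congˡ {toℚᵘ r} (toℚᵘ-ℕ→ℚ w))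

    +x*[1+d]≡ : ∀ x → ℤ.+ x ℤ.* ℤ.+ suc (d * 1) ≡ ℤ.+ (x * suc d)
    +x*[1+d]≡ x = trans (cong (λ e → ℤ.+ x ℤ.* ℤ.+ suc e) (*-identityʳ d)) (sym (ℤ.pos-* x (suc d)))

    +◃m*1≡ : ∀ m → (Sign.+ ℤ.◃ m) ℤ.* ℤ.+ 1 ≡ ℤ.+ m
    +◃m*1≡ m = trans (ℤ.*-identityʳ _) (ℤ.+◃n≡+n m)

  x≤r*w⇒x*[1+d]≤n*w : ∀ x w → ℕ→ℚ x ℚ.≤ r ℚ.* ℕ→ℚ w → x * suc d ≤ n * w
  x≤r*w⇒x*[1+d]≤n*w x w x≤rw
    with *≤* h ← ℚᵘ.≤-respʳ-≃ (toℚᵘ-r*ℕ→ℚ w) (ℚᵘ.≤-respˡ-≃ (toℚᵘ-ℕ→ℚ x) (ℚ.toℚᵘ-mono-≤ x≤rw))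
    = ℤ.drop‿+≤+ (subst₂ ℤ._≤_ (+x*[1+d]≡ x) (+◃m*1≡ (n * w)) h)

  x<r*w⇒x*[1+d]<n*w : ∀ x w → ℕ→ℚ x ℚ.< r ℚ.* ℕ→ℚ w → x * suc d < n * w
  x<r*w⇒x*[1+d]<n*w x w x<rw
    with *<* h ← ℚᵘ.<-respʳ-≃ (toℚᵘ-r*ℕ→ℚ w) (ℚᵘ.<-respˡ-≃ (toℚᵘ-ℕ→ℚ x) (ℚ.toℚᵘ-mono-< x<rw))
    = ℤ.drop‿+<+ (subst₂ ℤ._<_ (+x*[1+d]≡ x) (+◃m*1≡ (n * w)) h)

  r*x≤w⇒n*x≤w*[1+d] : ∀ x w → r ℚ.* ℕ→ℚ x ℚ.≤ ℕ→ℚ w → n * x ≤ w * suc d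
  r*x≤w⇒n*x≤w*[1+d] x w rx≤w
    with *≤* h ← ℚᵘ.≤-respˡ-≃ (toℚᵘ-r*ℕ→ℚ x) (ℚᵘ.≤-respʳ-≃ (toℚᵘ-ℕ→ℚ w) (ℚ.toℚᵘ-mono-≤ rx≤w))
    = ℤ.drop‿+≤+ (subst₂ ℤ._≤_ (+◃m*1≡ (n * x)) (+x*[1+d]≡ w) h)

Bad⇒lopsided : ∀ m {n₁ n₂} (E : BipGraph n₁ n₂) W v → Bad (mkℚ (ℤ.+ 1) m (1-coprimeTo _)) E W v →
               suc m * ∣ W ∩ N E v ∣ ≤ ∣ W ∣ ⊎ suc m * ∣ W ─ N E v ∣ ≤ ∣ W ∣
Bad⇒lopsided m E W v (inj₁ sparse) = inj₁ (begin
  suc m * ∣ W ∩ N E v ∣   ≡⟨ cong (λ p → suc m * ∣ p ∣) (∩-comm W (N E v)) ⟩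
  suc m * ∣ N E v ∩ W ∣   ≡⟨ *-comm (suc m) ∣ N E v ∩ W ∣ ⟩
  ∣ N E v ∩ W ∣ * suc m   ≤⟨ x≤r*w⇒x*[1+d]≤n*w 1 m (1-coprimeTo _) ∣ N E v ∩ W ∣ ∣ W ∣ sparse ⟩
  1 * ∣ W ∣               ≡⟨ *-identityˡ ∣ W ∣ ⟩
  ∣ W ∣                   ∎)
  where open ≤-Reasoning
Bad⇒lopsided m E W v (inj₂ co-sparse) = inj₂ (<⇒≤ (begin-strict
  suc m * ∣ W ─ N E v ∣   ≡⟨ *-comm (suc m) ∣ W ─ N E v ∣ ⟩
  ∣ W ─ N E v ∣ * suc m   <⟨ x<r*w⇒x*[1+d]<n*w 1 m (1-coprimeTo _) ∣ W ─ N E v ∣ ∣ W ∣ co-sparse ⟩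
  1 * ∣ W ∣               ≡⟨ *-identityˡ ∣ W ∣ ⟩
  ∣ W ∣                   ∎))
  where open ≤-Reasoning

-- For C = (1+k)/(1+q): logarithms are taken to base 2^D, and t = M·log_{2^D} n ≥ C·log₂ n.
-- D is opaque so that 2 ^ D k is never normalised.
opaque
  D : ℕ → ℕ
  D k = 20 + 10 * k

  2≤D : ∀ k → 2 ≤ D k
  2≤D k = s≤s (s≤s z≤n)

M : ℕ → ℕ
M k = D k * suc k

M≢0 : ∀ k → NonZero (M k)
M≢0 k = m*n≢0 (D k) (suc k) {{>-nonZero (≤-trans (s≤s z≤n) (2≤D k))}}

ε⁻¹ : ℕ → ℕ
ε⁻¹ k = 2 * suc (2 * M k)

ε : ℕ → ℚ
ε k = mkℚ (ℤ.+ 1) (pred (ε⁻¹ k)) (1-coprimeTo _)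

K : ℕ → ℕ
K k = 5 * (D k + 1 + M k) + (19 + 10 * k) * (D k + 5 + 5 * M k)

-- After cancelling, (D−1)·J₁ ≤ 2M·J₂ + (D+1+M) and (D−5)·J₂ < 5·J₁ + (D+5+5M);
-- eliminating J₁ works because 10M < (D−1)(D−5) for D = 10(k+2), M = D(k+1).
opaque
  unfolding D

  J₂<K : ∀ k J₁ J₂ →
    D k * J₁ ≤ D k + (1 + (2 * (M k * J₂) + (M k + J₁))) →
    D k * J₂ < D k + (1 + (J₁ + (M k + J₂))) * 5 →
    J₂ < K k
  J₂<K k J₁ J₂ J₁-bound J₂-bound = y<e*c+a*f (19 + 10 * k) (2 * M k) (D k + 1 + M k) (15 + 10 * k) 5 (D k + 5 + 5 * M k)
    J₁ J₂ J₁-bound′ J₂-bound′ (≤-trans (m≤m+n _ (84 + 40 * k)) (≤-reflexive (sym (e₃ k))))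
    where
    open ≤-Reasoning
    e₁ : ∀ k x → (20 + 10 * k) * x ≡ (19 + 10 * k) * x + x
    e₁ = solve-∀
    e₂ : ∀ k x y → 20 + 10 * k + (1 + (2 * ((20 + 10 * k) * suc k * y) + ((20 + 10 * k) * suc k + x)))
                   ≡ 2 * ((20 + 10 * k) * suc k) * y + (20 + 10 * k + 1 + (20 + 10 * k) * suc k) + x
    e₂ = solve-∀
    e₃ : ∀ k → (19 + 10 * k) * (15 + 10 * k) ≡ suc (5 * (2 * ((20 + 10 * k) * suc k))) + (84 + 40 * k)
    e₃ = solve-∀
    e₄ : ∀ k y → (20 + 10 * k) * y ≡ (15 + 10 * k) * y + 5 * y
    e₄ = solve-∀
    e₅ : ∀ k x y → 20 + 10 * k + (1 + (x + ((20 + 10 * k) * suc k + y))) * 5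
                   ≡ 5 * x + (20 + 10 * k + 5 + 5 * ((20 + 10 * k) * suc k)) + 5 * y
    e₅ = solve-∀
    J₁-bound′ : (19 + 10 * k) * J₁ ≤ 2 * M k * J₂ + (D k + 1 + M k)
    J₁-bound′ = +-cancelʳ-≤ J₁ _ _ (begin
      (19 + 10 * k) * J₁ + J₁                      ≡⟨ e₁ k J₁ ⟨
      D k * J₁                                     ≤⟨ J₁-bound ⟩
      D k + (1 + (2 * (M k * J₂) + (M k + J₁)))    ≡⟨ e₂ k J₁ J₂ ⟩
      2 * M k * J₂ + (D k + 1 + M k) + J₁          ∎)
    J₂-bound′ : (15 + 10 * k) * J₂ < 5 * J₁ + (D k + 5 + 5 * M k)
    J₂-bound′ = +-cancelʳ-< (5 * J₂) _ _ (begin-strict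
      (15 + 10 * k) * J₂ + 5 * J₂                  ≡⟨ e₄ k J₂ ⟨
      D k * J₂                                     <⟨ J₂-bound ⟩
      D k + (1 + (J₁ + (M k + J₂))) * 5            ≡⟨ e₅ k J₁ J₂ ⟩
      5 * J₁ + (D k + 5 + 5 * M k) + 5 * J₂        ∎)

module _ (k a d : ℕ) .(cδ : Coprime (suc a) (suc d)) where

  private
    δ : ℚ
    δ = mkℚ (ℤ.+ suc a) d cδ

    B : ℕ
    B = 2 ^ D k

    -- n ≥ G·t makes W (|W| ≥ δn) large compared with t.
    G : ℕ
    G = suc d * ε⁻¹ k

    4≤G : 4 ≤ G
    4≤G = ≤-trans (*-monoʳ-≤ 2 (s≤s (≤-trans (>-nonZero⁻¹ (M k) {{M≢0 k}}) (m≤n*m (M k) 2)))) (m≤n*m (ε⁻¹ k) (suc d))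

    1<B : 1 < B
    1<B = ^-monoʳ-< 2 (s≤s (s≤s z≤n)) {0} {D k} (≤-trans (s≤s z≤n) (2≤D k))

    J₀ : ℕ
    J₀ = K k + G * M k + 2

  rich-side : ∀ {n₁ n₂} (E : BipGraph n₁ n₂) J₁ J₂ →
    B ^ J₁ ≤ B * n₁ → B ^ J₂ ≤ B * n₂ → NoHomogeneous E (M k * J₁) (M k * J₂) →
    G * (M k * J₁) ≤ n₁ → G * (M k * J₂) ≤ n₂ → K k ≤ J₂ → RichSide δ (ε k) E
  rich-side {n₁} {n₂} E J₁ J₂ Bᴶ¹≤Bn₁ Bᴶ²≤Bn₂ no-hom Gt₁≤n₁ Gt₂≤n₂ K≤J₂ W δn₁≤∣W∣ S bad =
    ≮⇒≥ λ n₂<∣S∣⁵ → <⇒≱ (J₂<K k J₁ J₂ J₁-bound (J₂-bound n₂<∣S∣⁵)) K≤J₂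
    where
    open ≤-Reasoning
    t₁ t₂ : ℕ
    t₁ = M k * J₁
    t₂ = M k * J₂
    ε⁻¹t₁≤∣W∣ : ε⁻¹ k * t₁ ≤ ∣ W ∣
    ε⁻¹t₁≤∣W∣ = *-cancelˡ-≤ (suc d) (begin
      suc d * (ε⁻¹ k * t₁)   ≡⟨ *-assoc (suc d) (ε⁻¹ k) t₁ ⟨
      G * t₁                 ≤⟨ Gt₁≤n₁ ⟩
      n₁                     ≤⟨ m≤n*m n₁ (suc a) ⟩
      suc a * n₁             ≤⟨ r*x≤w⇒n*x≤w*[1+d] (suc a) d cδ n₁ ∣ W ∣ δn₁≤∣W∣ ⟩
      ∣ W ∣ * suc d          ≡⟨ *-comm ∣ W ∣ (suc d) ⟩
      suc d * ∣ W ∣          ∎)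
    lopsided : ∀ v → v ∈ S → ε⁻¹ k * ∣ W ∩ N E v ∣ ≤ ∣ W ∣ ⊎ ε⁻¹ k * ∣ W ─ N E v ∣ ≤ ∣ W ∣
    lopsided v v∈S = Bad⇒lopsided (pred (ε⁻¹ k)) E W v (bad v v∈S)
    ∣S∣≤2^[1+J₁+M+J₂] : ∣ S ∣ ≤ 2 ^ (1 + (J₁ + (M k + J₂)))
    ∣S∣≤2^[1+J₁+M+J₂] = begin
      ∣ S ∣                    ≤⟨ few-lopsided-vertices (M k) {{M≢0 k}} J₁ W S no-hom ε⁻¹t₁≤∣W∣ lopsided ⟩
      2 * (2 ^ J₁ * t₂)        ≤⟨ 2*[2^a*[b*c]]≤2^[1+[a+[b+c]]] J₁ (M k) J₂ ⟩
      2 ^ (1 + (J₁ + (M k + J₂))) ∎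
    n₁≤2^[1+2t₂+M+J₁] : n₁ ≤ 2 ^ (1 + (2 * t₂ + (M k + J₁)))
    n₁≤2^[1+2t₂+M+J₁] = begin
      n₁                        ≤⟨ n₂≤2*4^t₁*t₂ (transpose E) (NoHomogeneous-transpose no-hom)
                                     (≤-trans (*-monoˡ-≤ t₂ 4≤G) Gt₂≤n₂) ⟩
      2 * (4 ^ t₂ * t₁)         ≡⟨ cong (λ x → 2 * (x * t₁)) (^-*-assoc 2 2 t₂) ⟩
      2 * (2 ^ (2 * t₂) * t₁)   ≤⟨ 2*[2^a*[b*c]]≤2^[1+[a+[b+c]]] (2 * t₂) (M k) J₁ ⟩
      2 ^ (1 + (2 * t₂ + (M k + J₁))) ∎
    J₁-bound : D k * J₁ ≤ D k + (1 + (2 * t₂ + (M k + J₁)))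
    J₁-bound = log₂-≤ (D k) J₁ n₁ _ Bᴶ¹≤Bn₁ n₁≤2^[1+2t₂+M+J₁]
    J₂-bound : n₂ < ∣ S ∣ ^ 5 → D k * J₂ < D k + (1 + (J₁ + (M k + J₂))) * 5
    J₂-bound n₂<∣S∣⁵ = log₂-< (D k) J₂ n₂ _ Bᴶ²≤Bn₂ (begin-strict
      n₂                                   <⟨ n₂<∣S∣⁵ ⟩
      ∣ S ∣ ^ 5                            ≤⟨ ^-monoˡ-≤ 5 ∣S∣≤2^[1+J₁+M+J₂] ⟩
      (2 ^ (1 + (J₁ + (M k + J₂)))) ^ 5    ≡⟨ ^-*-assoc 2 (1 + (J₁ + (M k + J₂))) 5 ⟩
      2 ^ ((1 + (J₁ + (M k + J₂))) * 5)    ∎)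

  n₀ : ℕ
  n₀ = suc (B ^ J₀)

  ramsey⇒rich : ∀ q .(cC : Coprime (suc k) (suc q)) {n₁ n₂} (E : BipGraph n₁ n₂) →
    n₀ ≤ n₁ → n₀ ≤ n₂ → BipRamsey (mkℚ (ℤ.+ suc k) q cC) E → BipRich δ (ε k) E
  ramsey⇒rich q cC {n₁} {n₂} E n₀≤n₁ n₀≤n₂ ramsey
    with log-bracket B 1<B n₁ {{>-nonZero (≤-trans (s≤s z≤n) n₀≤n₁)}}
       | log-bracket B 1<B n₂ {{>-nonZero (≤-trans (s≤s z≤n) n₀≤n₂)}}
  ... | J₁ , n₁≤Bᴶ¹ , Bᴶ¹≤Bn₁ | J₂ , n₂≤Bᴶ² , Bᴶ²≤Bn₂ =
    rich-side E J₁ J₂ Bᴶ¹≤Bn₁ Bᴶ²≤Bn₂ no-hom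
      (large J₁ Bᴶ¹≤Bn₁ J₀<J₁) (large J₂ Bᴶ²≤Bn₂ J₀<J₂) (K≤ J₀<J₂) ,
    rich-side (transpose E) J₂ J₁ Bᴶ²≤Bn₂ Bᴶ¹≤Bn₁ (NoHomogeneous-transpose no-hom)
      (large J₂ Bᴶ²≤Bn₂ J₀<J₂) (large J₁ Bᴶ¹≤Bn₁ J₀<J₁) (K≤ J₀<J₁)
    where
    open ≤-Reasoning
    J₀<J₁ : J₀ < J₁
    J₀<J₁ = ^-cancelˡ-< B 1<B (≤-trans n₀≤n₁ n₁≤Bᴶ¹)
    J₀<J₂ : J₀ < J₂
    J₀<J₂ = ^-cancelˡ-< B 1<B (≤-trans n₀≤n₂ n₂≤Bᴶ²)
    K≤ : ∀ {J} → J₀ < J → K k ≤ J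
    K≤ J₀<J = ≤-trans (m≤m+n (K k) _) (≤-trans (m≤m+n _ 2) (<⇒≤ J₀<J))
    large : ∀ {n} J → B ^ J ≤ B * n → J₀ < J → G * (M k * J) ≤ n
    large J Bᴶ≤Bn J₀<J =
      G*[M*J]≤n (D k) G (M k) J _ (2≤D k) Bᴶ≤Bn
        (≤-trans (+-monoˡ-≤ 2 (m≤n+m (G * M k) (K k))) (<⇒≤ J₀<J))
    t-large : ∀ {n} J → n ≤ B ^ J → AtLeastClog (mkℚ (ℤ.+ suc k) q cC) n (M k * J)
    t-large {n} J n≤Bᴶ = begin
      n ^ suc k                    ≤⟨ ^-monoˡ-≤ (suc k) n≤Bᴶ ⟩
      (B ^ J) ^ suc k              ≡⟨ cong (_^ suc k) (^-*-assoc 2 (D k) J) ⟩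
      (2 ^ (D k * J)) ^ suc k      ≡⟨ ^-*-assoc 2 (D k * J) (suc k) ⟩
      2 ^ (D k * J * suc k)        ≡⟨ cong (2 ^_) (e (D k) J k) ⟩
      2 ^ (M k * J)                ≤⟨ ^-monoʳ-≤ 2 (m≤m*n (M k * J) (suc q)) ⟩
      2 ^ (M k * J * suc q)        ∎
      where
      e : ∀ D J k → D * J * suc k ≡ D * suc k * J
      e = solve-∀
    no-hom : NoHomogeneous E (M k * J₁) (M k * J₂)
    no-hom = BipRamsey⇒NoHomogeneous {mkℚ (ℤ.+ suc k) q cC} ramsey (t-large J₁ n₁≤Bᴶ¹) (t-large J₂ n₂≤Bᴶ²)

lemma2p5 : ∀ (C δ : ℚ) → Positive C → Positive δ →
    Σ ℚ λ ε → Σ ℕ λ n₀ → Positive ε ×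
      (∀ (n₁ n₂ : ℕ) (E : BipGraph n₁ n₂) → n₁ ≥ n₀ → n₂ ≥ n₀ →
        BipRamsey C E → BipRich δ ε E)
lemma2p5 (mkℚ (ℤ.+ zero) _ _) _ (record { pos = () }) _
lemma2p5 (mkℚ ℤ.-[1+ _ ] _ _) _ (record { pos = () }) _
lemma2p5 (mkℚ ℤ.+[1+ _ ] _ _) (mkℚ (ℤ.+ zero) _ _) _ (record { pos = () })
lemma2p5 (mkℚ ℤ.+[1+ _ ] _ _) (mkℚ ℤ.-[1+ _ ] _ _) _ (record { pos = () })
lemma2p5 (mkℚ ℤ.+[1+ k ] q cC) (mkℚ ℤ.+[1+ a ] d cδ) _ _ =
  ε k , n₀ k a d cδ , _ , λ n₁ n₂ E n₀≤n₁ n₀≤n₂ → ramsey⇒rich k a d cδ q cC E n₀≤n₁ n₀≤n₂
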